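{- Let $(\mathbb{Z}^n,E)$ be a PL graph with edge vectors $v_1,\dots,v_k$ and let $S\subset\mathbb{Z}^n$ be finite. Then $$|\partial_e(S)|=2\sum_{i=1}^k\big(|P_{v_i}(S)|+|\mathrm{gap}_{v_i}(S)|\big).$$
   Context: A PL graph is a simple graph $G=(V,E)$ with $V=\mathbb{Z}^n$ for which there exist integer vectors $v_1,\dots,v_k$ with $v_i\neq -v_j$ for all $i,j$, such that for every $u\in\mathbb{Z}^n$ the edges containing $u$ are exactly $(u,u\pm v_1),\dots,(u,u\pm v_k)$; each $v_i$ has relatively prime entries; and $v_1,\dots,v_k$ span $\mathbb{R}^n$. The edge boundary is $\partial_e(S)=\{(u,v)\in E:|\{u,v\}\cap S|=1\}$. $P_{v_i}(S)=\{u-\frac{\langle u,v_i\rangle}{\|v_i\|_2^2}v_i: u\in S\}$ is the orthogonal projection of $S$ onto the hyperplane perpendicular to $v_i$. $\mathrm{gap}_{v_i}(S)=\{x\in\mathbb{Z}^n: x-v_i\in S,\ x\notin S,\ x+bv_i\in S\text{ for some integer }b\ge1\}$. -}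

module Defs where

open import Data.Nat as ℕ using (ℕ; zero; suc)
open import Data.Nat.GCD using (gcd)
open import Data.Integer as ℤ using (ℤ; +_; ∣_∣)
open import Data.Rational as ℚ using (ℚ)
open import Data.Fin using (Fin)
open import Data.Vec using (Vec; []; _∷_; map; zipWith; foldr)
open import Data.List using (List; length)
open import Data.List.Membership.Propositional using (_∈_)
open import Data.List.Relation.Unary.All using (All)
open import Data.List.Relation.Unary.Any using (Any)
open import Data.List.Relation.Unary.AllPairs using (AllPairs)
open import Data.Product using (Σ; ∃; _×_)
open import Data.Sum using (_⊎_)
open import Relation.Binary.PropositionalEquality using (_≡_)
open import Relation.Nullary using (¬_)

Pt : ℕ → Set
Pt n = Vec ℤ n

_⊕_ : ∀ {n} → Pt n → Pt n → Pt n
_⊕_ = zipWith ℤ._+_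

_⊖_ : ∀ {n} → Pt n → Pt n → Pt n
_⊖_ = zipWith ℤ._-_

negV : ∀ {n} → Pt n → Pt n
negV = map (λ z → ℤ.- z)

_·_ : ∀ {n} → ℤ → Pt n → Pt n
c · v = map (c ℤ.*_) v

⟪_,_⟫ : ∀ {n} → Pt n → Pt n → ℤ
⟪ u , v ⟫ = foldr _ ℤ._+_ (+ 0) (zipWith ℤ._*_ u v)

normSq : ∀ {n} → Pt n → ℕ
normSq v = ∣ ⟪ v , v ⟫ ∣

gcdEntries : ∀ {n} → Pt n → ℕ
gcdEntries v = foldr _ (λ z g → gcd ∣ z ∣ g) 0 v

toℚ : ℤ → ℚ
toℚ z = z ℚ./ 1

-- 1/m in ℚ for m ≠ 0 (value 0 at m = 0; never used there, since edge
-- vectors are nonzero)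
inv : ℕ → ℚ
inv zero = ℚ.0ℚ
inv (suc m) = (+ 1) ℚ./ (suc m)

proj : ∀ {n} → Pt n → Pt n → Vec ℚ n
proj v u = zipWith (λ ui vi → toℚ ui ℚ.- (c ℚ.* toℚ vi)) u v
  where c = toℚ ⟪ u , v ⟫ ℚ.* inv (normSq v)

sumFin : ∀ {k} → (Fin k → ℕ) → ℕ
sumFin {zero} f = 0
sumFin {suc k} f = f Fin.zero ℕ.+ sumFin (λ i → f (Fin.suc i))
  where import Data.Fin as Fin

lincomb : ∀ {n k} → (Fin k → ℚ) → (Fin k → Pt n) → Vec ℚ n
lincomb {n} {zero} c vs = Data.Vec.replicate n ℚ.0ℚ
  where import Data.Vec
lincomb {n} {suc k} c vs =
  zipWith ℚ._+_ (map (λ z → c Fin.zero ℚ.* toℚ z) (vs Fin.zero))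
                (lincomb (λ i → c (Fin.suc i)) (λ i → vs (Fin.suc i)))
  where import Data.Fin as Fin

record IsPL (n k : ℕ) (vs : Fin k → Pt n) : Set where
  field
    -- vᵢ ≠ -vⱼ for all i, j (in particular vᵢ ≠ 0)
    notOpp   : ∀ i j → ¬ (vs i ≡ negV (vs j))
    -- the edge vectors are listed without repetition (so the 2k edges
    -- (u, u ± vᵢ) at u are distinct, as in the definition)
    distinct : ∀ i j → vs i ≡ vs j → i ≡ j
    coprime : ∀ i → gcdEntries (vs i) ≡ 1
    -- v₁,…,v_k span ℝⁿ (equivalently ℚⁿ, as they are integer vectors)
    spanning : ∀ (x : Vec ℚ n) → ∃ λ (c : Fin k → ℚ) → lincomb c vs ≡ x

Adj : ∀ {n k} → (Fin k → Pt n) → Pt n → Pt n → Set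
Adj vs u w = ∃ λ i → (w ≡ u ⊕ vs i) ⊎ (w ≡ u ⊖ vs i)

SameEdge : ∀ {n} → Pt n × Pt n → Pt n × Pt n → Set
SameEdge (u Data.Product., w) (u' Data.Product., w') =
  (u ≡ u' × w ≡ w') ⊎ (u ≡ w' × w ≡ u')
  where import Data.Product

InBoundary : ∀ {n k} → (Fin k → Pt n) → List (Pt n) → Pt n × Pt n → Set
InBoundary vs S (u Data.Product., w) =
  Adj vs u w × ((u ∈ S × ¬ (w ∈ S)) ⊎ (¬ (u ∈ S) × w ∈ S))
  where import Data.Product

InProj : ∀ {n} → Pt n → List (Pt n) → Vec ℚ n → Set
InProj v S p = ∃ λ u → u ∈ S × p ≡ proj v u

InGap : ∀ {n} → Pt n → List (Pt n) → Pt n → Set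
InGap v S x = (x ⊖ v) ∈ S × ¬ (x ∈ S)
            × ∃ λ (b : ℕ) → 1 ℕ.≤ b × (x ⊕ ((+ b) · v)) ∈ S

-- HasCard _≈_ P m : the set {a | P a}, with elements identified up to
-- _≈_, has exactly m elements: listed by a duplicate-free (up to ≈)
-- list of length m covering it.
HasCard : {A : Set} → (A → A → Set) → (A → Set) → ℕ → Set
HasCard {A} _≈_ P m = Σ (List A) λ xs →
  length xs ≡ m × All P xs × AllPairs (λ a b → ¬ (a ≈ b)) xs
  × (∀ a → P a → Any (a ≈_) xs)

-- Fix an edge vector v. The boundary edges along ±v are the pairs (x , x ± v) with x ∈ S and
-- x ± v ∉ S. Translation by v matches {x ∈ S | x + v ∈ S} with {x ∈ S | x - v ∈ S}, so both signs
-- contribute the number of exits: points x ∈ S with x + v ∉ S. An exit x is either the last point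
-- of S on its line x + ℤv, or some point of S lies further along and x + v ∈ gap_v(S); the second
-- kind is in bijection with gap_v(S). Last points of distinct lines have distinct projections:
-- v is primitive, so Bézout gives an integer a with ⟨v,a⟩ = 1, making ⟨-,a⟩ an integer
-- coordinate along each line, and two points with equal projection differ by an integer multiple
-- of v. Summing over the edge vectors gives the formula.

module Submission where

open import Defs
open import Data.Nat as ℕ using (ℕ; zero; suc; s≤s; z≤n)
import Data.Nat.Properties as ℕP
open import Data.Nat.GCD using (gcd; gcd-GCD; module Bézout)
import Data.Integer
open Data.Integer using (ℤ; +_; -[1+_]; ∣_∣; +<+)
import Data.Integer.Properties as ℤP
open import Data.Integer.Tactic.RingSolver using (solve-∀)
open import Algebra.Properties.AbelianGroup ℤP.+-0-abelianGroup using (∙-cancelˡ)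
open import Data.Rational as ℚ using (ℚ)
import Data.Rational.Properties as ℚP
open import Data.Rational.Unnormalised as ℚᵘ using (mkℚᵘ; *≡*)
import Data.Rational.Unnormalised.Properties as ℚᵘP
open import Data.Rational.Solver using (module +-*-Solver)
open import Data.Fin as Fin using (Fin)
import Data.Fin.Properties as FinP
open import Data.Vec as Vec using (Vec; []; _∷_)
open import Data.Vec.Properties using (∷-injective; ≡-dec)
open import Data.List using (List; []; _∷_; length; filter; map; _++_; deduplicate)
import Data.List.Properties as ListP
open import Data.List.Extrema ℤP.≤-totalOrder using (argmax; argmax-all; f[xs]≤f[argmax])
open import Data.List.Membership.Propositional using (_∈_; _∉_; lose; find)
open import Data.List.Membership.Propositional.Properties
  using (∈-filter⁺; ∈-filter⁻; ∈-map⁺; ∈-map⁻; ∈-map∘filter⁻; ∈-++⁺ˡ; ∈-++⁺ʳ; ∈-++⁻; ∈-deduplicate⁺; ∈-deduplicate⁻)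
open import Data.List.Membership.Propositional.Properties.WithK using (unique∧set⇒bag)
import Data.List.Membership.DecPropositional as DecMembership
open import Data.List.Relation.Binary.BagAndSetEquality using (∼bag⇒↭)
open import Data.List.Relation.Binary.Permutation.Propositional.Properties using (↭-length)
open import Data.List.Relation.Unary.All as All using (All; []; _∷_)
open import Data.List.Relation.Unary.Any using (Any; any?)
open import Data.List.Relation.Unary.AllPairs using (AllPairs; []; _∷_)
import Data.List.Relation.Unary.AllPairs.Properties as AllPairsP
open import Data.List.Relation.Unary.Unique.Propositional using (Unique)
import Data.List.Relation.Unary.Unique.Propositional.Properties as UniqueP
open import Data.List.Relation.Unary.Unique.DecPropositional.Properties using (deduplicate-!)
open import Data.Bool using (true; false)
open import Data.Product using (Σ; ∃; ∃₂; _×_; _,_; proj₁; proj₂)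
open import Data.Sum using (_⊎_; inj₁; inj₂; reduce)
open import Data.Empty using (⊥; ⊥-elim)
open import Function using (_∘_; _⇔_; mk⇔; Injective; case_of_)
open import Level using (0ℓ)
open import Relation.Nullary using (¬_; Dec; no; ¬?; does; contradiction)
import Relation.Nullary.Decidable as Dec
open import Relation.Unary using (Pred; Decidable)
open import Relation.Binary.Definitions using (DecidableEquality)
open import Relation.Binary.PropositionalEquality

module _ {A : Set} where

  length-filter-split : ∀ {P : Pred A 0ℓ} (P? : Decidable P) xs →
    length (filter P? xs) ℕ.+ length (filter (¬? ∘ P?) xs) ≡ length xs
  length-filter-split P? []       = refl
  length-filter-split P? (x ∷ xs) with does (P? x)
  ... | true  = cong suc (length-filter-split P? xs)
  ... | false = trans (ℕP.+-suc _ _) (cong suc (length-filter-split P? xs))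

  unique-set⇒length≡ : ∀ {xs ys : List A} → Unique xs → Unique ys →
    (∀ {z} → z ∈ xs ⇔ z ∈ ys) → length xs ≡ length ys
  unique-set⇒length≡ xs! ys! xs≈ys = ↭-length (∼bag⇒↭ (unique∧set⇒bag xs! ys! xs≈ys))

  AllPairs-mapWithAll : ∀ {P : Pred A 0ℓ} {R R′ : A → A → Set} {xs} → All P xs →
    (∀ {a b} → P a → P b → R a b → R′ a b) → AllPairs R xs → AllPairs R′ xs
  AllPairs-mapWithAll []         f []           = []
  AllPairs-mapWithAll (pa ∷ pxs) f (Rax ∷ Rxs) =
    All.zipWith (λ (pb , Rab) → f pa pb Rab) (pxs , Rax) ∷ AllPairs-mapWithAll pxs f Rxs

  hasCard : ∀ {P : A → Set} {xs} → Unique xs → (∀ {a} → a ∈ xs → P a) → (∀ {a} → P a → a ∈ xs) →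
    HasCard _≡_ P (length xs)
  hasCard {xs = xs} xs! sound complete = xs , refl , All.tabulate sound , xs! , λ _ → complete

sumFin-cong : ∀ {k} {f g : Fin k → ℕ} → (∀ i → f i ≡ g i) → sumFin f ≡ sumFin g
sumFin-cong {zero}  f≗g = refl
sumFin-cong {suc k} f≗g = cong₂ ℕ._+_ (f≗g Fin.zero) (sumFin-cong (f≗g ∘ Fin.suc))

map-unique-on : ∀ {A B : Set} {f : A → B} {xs} → Unique xs →
  (∀ {a b} → a ∈ xs → b ∈ xs → f a ≡ f b → a ≡ b) → Unique (map f xs)
map-unique-on xs! f-inj = AllPairsP.map⁺ (AllPairs-mapWithAll (All.tabulate (λ a∈ → a∈))
  (λ a∈ b∈ a≢b fa≡fb → a≢b (f-inj a∈ b∈ fa≡fb)) xs!)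

map-injective : ∀ {A B : Set} {f : A → B} → Injective _≡_ _≡_ f → ∀ {k} → Injective _≡_ _≡_ (Vec.map {n = k} f)
map-injective f-inj {x = []}    {[]}    _  = refl
map-injective f-inj {x = a ∷ x} {b ∷ y} eq with ∷-injective eq
... | fa≡fb , fx≡fy = cong₂ _∷_ (f-inj fa≡fb) (map-injective f-inj fx≡fy)

module Lattice where
  open Data.Integer using (_+_; _-_; _*_; -_)

  x⊕v⊕-v≡x : ∀ {n} (x v : Pt n) → (x ⊕ v) ⊕ negV v ≡ x
  x⊕v⊕-v≡x []      []      = refl
  x⊕v⊕-v≡x (a ∷ x) (b ∷ v) = cong₂ _∷_ (a+b-b≡a a b) (x⊕v⊕-v≡x x v)
    where a+b-b≡a : ∀ a b → a + b + - b ≡ a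
          a+b-b≡a = solve-∀

  x⊕-v⊕v≡x : ∀ {n} (x v : Pt n) → (x ⊕ negV v) ⊕ v ≡ x
  x⊕-v⊕v≡x []      []      = refl
  x⊕-v⊕v≡x (a ∷ x) (b ∷ v) = cong₂ _∷_ (a-b+b≡a a b) (x⊕-v⊕v≡x x v)
    where a-b+b≡a : ∀ a b → a + - b + b ≡ a
          a-b+b≡a = solve-∀

  x⊖v≡x⊕-v : ∀ {n} (x v : Pt n) → x ⊖ v ≡ x ⊕ negV v
  x⊖v≡x⊕-v []      []      = refl
  x⊖v≡x⊕-v (a ∷ x) (b ∷ v) = cong (_ ∷_) (x⊖v≡x⊕-v x v)

  ⊕-cancelˡ : ∀ {n} (x : Pt n) {v w} → x ⊕ v ≡ x ⊕ w → v ≡ w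
  ⊕-cancelˡ []      {[]}    {[]}    _  = refl
  ⊕-cancelˡ (a ∷ x) {b ∷ v} {c ∷ w} eq with ∷-injective eq
  ... | a+b≡a+c , x⊕v≡x⊕w = cong₂ _∷_ (∙-cancelˡ a b c a+b≡a+c) (⊕-cancelˡ x x⊕v≡x⊕w)

  ⊕-cancelʳ : ∀ {n} (v : Pt n) {x y} → x ⊕ v ≡ y ⊕ v → x ≡ y
  ⊕-cancelʳ v {x} {y} eq = trans (sym (x⊕v⊕-v≡x x v)) (trans (cong (_⊕ negV v) eq) (x⊕v⊕-v≡x y v))

  negV-involutive : ∀ {n} (v : Pt n) → negV (negV v) ≡ v
  negV-involutive []      = refl
  negV-involutive (a ∷ v) = cong₂ _∷_ (ℤP.neg-involutive a) (negV-involutive v)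

  x⊕0·v≡x : ∀ {n} (x v : Pt n) → x ⊕ ((+ 0) · v) ≡ x
  x⊕0·v≡x []      []      = refl
  x⊕0·v≡x (a ∷ x) (b ∷ v) = cong₂ _∷_ (a+0b≡a a b) (x⊕0·v≡x x v)
    where a+0b≡a : ∀ a b → a + + 0 * b ≡ a
          a+0b≡a = solve-∀

  x⊕1·v≡x⊕v : ∀ {n} (x v : Pt n) → x ⊕ ((+ 1) · v) ≡ x ⊕ v
  x⊕1·v≡x⊕v []      []      = refl
  x⊕1·v≡x⊕v (a ∷ x) (b ∷ v) = cong₂ _∷_ (a+1b≡a+b a b) (x⊕1·v≡x⊕v x v)
    where a+1b≡a+b : ∀ a b → a + + 1 * b ≡ a + b
          a+1b≡a+b = solve-∀

  x⊕s·v⊕t·v≡x⊕[s+t]·v : ∀ {n} (x v : Pt n) s t → (x ⊕ (s · v)) ⊕ (t · v) ≡ x ⊕ ((s + t) · v)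
  x⊕s·v⊕t·v≡x⊕[s+t]·v []      []      s t = refl
  x⊕s·v⊕t·v≡x⊕[s+t]·v (a ∷ x) (b ∷ v) s t =
    cong₂ _∷_ (distrib a b s t) (x⊕s·v⊕t·v≡x⊕[s+t]·v x v s t)
    where distrib : ∀ a b s t → a + s * b + t * b ≡ a + (s + t) * b
          distrib = solve-∀

  x⊕v⊕b·v≡x⊕[1+b]·v : ∀ {n} (x v : Pt n) b → (x ⊕ v) ⊕ ((+ b) · v) ≡ x ⊕ ((+ suc b) · v)
  x⊕v⊕b·v≡x⊕[1+b]·v x v b = trans (cong (_⊕ ((+ b) · v)) (sym (x⊕1·v≡x⊕v x v))) (x⊕s·v⊕t·v≡x⊕[s+t]·v x v (+ 1) (+ b))

  x⊕[-t]·v⊕t·v≡x : ∀ {n} (x v : Pt n) t → (x ⊕ ((- t) · v)) ⊕ (t · v) ≡ x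
  x⊕[-t]·v⊕t·v≡x x v t = begin
    (x ⊕ ((- t) · v)) ⊕ (t · v) ≡⟨ x⊕s·v⊕t·v≡x⊕[s+t]·v x v (- t) t ⟩
    x ⊕ ((- t + t) · v)         ≡⟨ cong (λ s → x ⊕ (s · v)) (ℤP.+-inverseˡ t) ⟩
    x ⊕ ((+ 0) · v)             ≡⟨ x⊕0·v≡x x v ⟩
    x                           ∎
    where open ≡-Reasoning

  ⟪⟫-comm : ∀ {n} (x y : Pt n) → ⟪ x , y ⟫ ≡ ⟪ y , x ⟫
  ⟪⟫-comm []      []      = refl
  ⟪⟫-comm (a ∷ x) (b ∷ y) = cong₂ _+_ (ℤP.*-comm a b) (⟪⟫-comm x y)

  ⟪⟫-homogeneousˡ : ∀ {n} t (x y : Pt n) → ⟪ t · x , y ⟫ ≡ t * ⟪ x , y ⟫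
  ⟪⟫-homogeneousˡ t []      []      = sym (ℤP.*-zeroʳ t)
  ⟪⟫-homogeneousˡ t (a ∷ x) (b ∷ y) = begin
    (t * a) * b + ⟪ t · x , y ⟫ ≡⟨ cong (λ r → (t * a) * b + r) (⟪⟫-homogeneousˡ t x y) ⟩
    (t * a) * b + t * ⟪ x , y ⟫ ≡⟨ factor t a b ⟪ x , y ⟫ ⟩
    t * (a * b + ⟪ x , y ⟫)     ∎
    where
    open ≡-Reasoning
    factor : ∀ t a b r → (t * a) * b + t * r ≡ t * (a * b + r)
    factor = solve-∀

  ⟪⟫-linearˡ : ∀ {n} (x w y : Pt n) t → ⟪ x ⊕ (t · w) , y ⟫ ≡ ⟪ x , y ⟫ + t * ⟪ w , y ⟫
  ⟪⟫-linearˡ []      []      []      t = sym (trans (ℤP.+-identityˡ (t * + 0)) (ℤP.*-zeroʳ t))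
  ⟪⟫-linearˡ (a ∷ x) (c ∷ w) (b ∷ y) t = begin
    (a + t * c) * b + ⟪ x ⊕ (t · w) , y ⟫             ≡⟨ cong (λ r → (a + t * c) * b + r) (⟪⟫-linearˡ x w y t) ⟩
    (a + t * c) * b + (⟪ x , y ⟫ + t * ⟪ w , y ⟫)     ≡⟨ regroup a c b t ⟪ x , y ⟫ ⟪ w , y ⟫ ⟩
    (a * b + ⟪ x , y ⟫) + t * (c * b + ⟪ w , y ⟫)     ∎
    where
    open ≡-Reasoning
    regroup : ∀ a c b t r s → (a + t * c) * b + (r + t * s) ≡ (a * b + r) + t * (c * b + s)
    regroup = solve-∀

  sumSq : ∀ {n} → Pt n → ℕ
  sumSq []      = 0
  sumSq (a ∷ v) = ∣ a ∣ ℕ.* ∣ a ∣ ℕ.+ sumSq v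

  ⟪v,v⟫≡sumSq : ∀ {n} (v : Pt n) → ⟪ v , v ⟫ ≡ + sumSq v
  ⟪v,v⟫≡sumSq []      = refl
  ⟪v,v⟫≡sumSq (a ∷ v) = begin
    a * a + ⟪ v , v ⟫                  ≡⟨ cong₂ _+_ (a*a≡∣a∣*∣a∣ a) (⟪v,v⟫≡sumSq v) ⟩
    + (∣ a ∣ ℕ.* ∣ a ∣) + + sumSq v    ≡⟨ ℤP.pos-+ (∣ a ∣ ℕ.* ∣ a ∣) (sumSq v) ⟨
    + (∣ a ∣ ℕ.* ∣ a ∣ ℕ.+ sumSq v)    ∎
    where
    open ≡-Reasoning
    a*a≡∣a∣*∣a∣ : ∀ a → a * a ≡ + (∣ a ∣ ℕ.* ∣ a ∣)
    a*a≡∣a∣*∣a∣ (+ m)    = sym (ℤP.pos-* m m)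
    a*a≡∣a∣*∣a∣ -[1+ m ] = refl

  normSq≡sumSq : ∀ {n} (v : Pt n) → normSq v ≡ sumSq v
  normSq≡sumSq v = cong ∣_∣ (⟪v,v⟫≡sumSq v)

  sumSq≡0⇒v≡-v : ∀ {n} (v : Pt n) → sumSq v ≡ 0 → v ≡ negV v
  sumSq≡0⇒v≡-v []      _  = refl
  sumSq≡0⇒v≡-v (a ∷ v) eq =
    cong₂ _∷_ (a≡-a (ℤP.∣i∣≡0⇒i≡0 ∣a∣≡0)) (sumSq≡0⇒v≡-v v (ℕP.m+n≡0⇒n≡0 (∣ a ∣ ℕ.* ∣ a ∣) eq))
    where
    ∣a∣≡0 : ∣ a ∣ ≡ 0
    ∣a∣≡0 = reduce (ℕP.m*n≡0⇒m≡0∨n≡0 ∣ a ∣ (ℕP.m+n≡0⇒m≡0 (∣ a ∣ ℕ.* ∣ a ∣) eq))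
    a≡-a : a ≡ + 0 → a ≡ - a
    a≡-a refl = refl

  normSq≡1+ : ∀ {n} (v : Pt n) → ¬ v ≡ negV v → ∃ λ m → normSq v ≡ suc m
  normSq≡1+ v v≢-v with normSq v in ‖v‖²≡
  ... | zero  = ⊥-elim (v≢-v (sumSq≡0⇒v≡-v v (trans (sym (normSq≡sumSq v)) ‖v‖²≡)))
  ... | suc m = m , refl

  pos-affine : ∀ a b c d e → a ℕ.+ b ℕ.* c ≡ d ℕ.* e → + a + + b * + c ≡ + d * + e
  pos-affine a b c d e eq = begin
    + a + + b * + c     ≡⟨ cong (λ r → + a + r) (ℤP.pos-* b c) ⟨
    + a + + (b ℕ.* c)   ≡⟨ ℤP.pos-+ a (b ℕ.* c) ⟨
    + (a ℕ.+ b ℕ.* c)   ≡⟨ cong +_ eq ⟩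
    + (d ℕ.* e)         ≡⟨ ℤP.pos-* d e ⟩
    + d * + e           ∎
    where open ≡-Reasoning

  bézout : ∀ m n → ∃₂ λ x y → x * + m + y * + n ≡ + gcd m n
  bézout m n with Bézout.identity (gcd-GCD m n)
  ... | Bézout.+- x y eq = + x , - + y , (begin
    + x * + m + - + y * + n              ≡⟨ cong (_+ - + y * + n) (pos-affine (gcd m n) y n x m eq) ⟨
    + gcd m n + + y * + n + - + y * + n  ≡⟨ cancel (+ gcd m n) (+ y) (+ n) ⟩
    + gcd m n                            ∎)
    where
    open ≡-Reasoning
    cancel : ∀ g y n → g + y * n + - y * n ≡ g
    cancel = solve-∀
  ... | Bézout.-+ x y eq = - + x , + y , (begin
    - + x * + m + + y * + n              ≡⟨ cong (λ r → - + x * + m + r) (pos-affine (gcd m n) x m y n eq) ⟨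
    - + x * + m + (+ gcd m n + + x * + m) ≡⟨ cancel (+ gcd m n) (+ x) (+ m) ⟩
    + gcd m n                            ∎)
    where
    open ≡-Reasoning
    cancel : ∀ g x m → - x * m + (g + x * m) ≡ g
    cancel = solve-∀

  ∣z∣-as-multiple : ∀ z → ∃ λ c → c * z ≡ + ∣ z ∣
  ∣z∣-as-multiple (+ m)    = + 1 , ℤP.*-identityˡ (+ m)
  ∣z∣-as-multiple -[1+ m ] = - + 1 , ℤP.-1*i≡-i -[1+ m ]

  bézoutᵥ : ∀ {n} (v : Pt n) → ∃ λ a → ⟪ a , v ⟫ ≡ + gcdEntries v
  bézoutᵥ []      = [] , refl
  bézoutᵥ (z ∷ v) with ∣z∣-as-multiple z | bézoutᵥ v | bézout ∣ z ∣ (gcdEntries v)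
  ... | c , cz≡∣z∣ | a , a·v≡g | x , y , bézout-identity = (x * c ∷ y · a) , (begin
    (x * c) * z + ⟪ y · a , v ⟫          ≡⟨ cong₂ _+_ (ℤP.*-assoc x c z) (⟪⟫-homogeneousˡ y a v) ⟩
    x * (c * z) + y * ⟪ a , v ⟫          ≡⟨ cong₂ (λ p q → x * p + y * q) cz≡∣z∣ a·v≡g ⟩
    x * (+ ∣ z ∣) + y * + (gcdEntries v)  ≡⟨ bézout-identity ⟩
    + gcd ∣ z ∣ (gcdEntries v)           ∎)
    where open ≡-Reasoning

open Lattice

module Rationals where
  open Data.Integer using (_+_; _*_; -_)

  toℚᵘ-toℚ : ∀ z → ℚ.toℚᵘ (toℚ z) ℚᵘ.≃ mkℚᵘ z 0
  toℚᵘ-toℚ z = ℚP.toℚᵘ-fromℚᵘ (mkℚᵘ z 0)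

  toℚ-+ : ∀ a b → toℚ (a + b) ≡ toℚ a ℚ.+ toℚ b
  toℚ-+ a b = ℚP.toℚᵘ-injective (begin
    ℚ.toℚᵘ (toℚ (a + b))                   ≈⟨ toℚᵘ-toℚ (a + b) ⟩
    mkℚᵘ (a + b) 0                         ≈⟨ *≡* (sum≡ a b) ⟩
    mkℚᵘ a 0 ℚᵘ.+ mkℚᵘ b 0                 ≈⟨ ℚᵘP.+-cong (toℚᵘ-toℚ a) (toℚᵘ-toℚ b) ⟨
    ℚ.toℚᵘ (toℚ a) ℚᵘ.+ ℚ.toℚᵘ (toℚ b)     ≈⟨ ℚP.toℚᵘ-homo-+ (toℚ a) (toℚ b) ⟨
    ℚ.toℚᵘ (toℚ a ℚ.+ toℚ b)               ∎)
    where
    open ℚᵘP.≃-Reasoning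
    sum≡ : ∀ a b → (a + b) * + 1 ≡ (a * + 1 + b * + 1) * + 1
    sum≡ = solve-∀

  toℚ-* : ∀ a b → toℚ (a * b) ≡ toℚ a ℚ.* toℚ b
  toℚ-* a b = ℚP.toℚᵘ-injective (begin
    ℚ.toℚᵘ (toℚ (a * b))                   ≈⟨ toℚᵘ-toℚ (a * b) ⟩
    mkℚᵘ (a * b) 0                         ≈⟨ *≡* refl ⟩
    mkℚᵘ a 0 ℚᵘ.* mkℚᵘ b 0                 ≈⟨ ℚᵘP.*-cong (toℚᵘ-toℚ a) (toℚᵘ-toℚ b) ⟨
    ℚ.toℚᵘ (toℚ a) ℚᵘ.* ℚ.toℚᵘ (toℚ b)     ≈⟨ ℚP.toℚᵘ-homo-* (toℚ a) (toℚ b) ⟨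
    ℚ.toℚᵘ (toℚ a ℚ.* toℚ b)               ∎)
    where open ℚᵘP.≃-Reasoning

  toℚ-neg : ∀ a → toℚ (- a) ≡ ℚ.- toℚ a
  toℚ-neg a = ℚP.toℚᵘ-injective (begin
    ℚ.toℚᵘ (toℚ (- a))                     ≈⟨ toℚᵘ-toℚ (- a) ⟩
    mkℚᵘ (- a) 0                           ≈⟨ ℚᵘP.-‿cong (toℚᵘ-toℚ a) ⟨
    ℚᵘ.- ℚ.toℚᵘ (toℚ a)                    ≈⟨ ℚP.toℚᵘ-homo‿- (toℚ a) ⟨
    ℚ.toℚᵘ (ℚ.- toℚ a)                     ∎)
    where open ℚᵘP.≃-Reasoning

  toℚ-injective : Injective _≡_ _≡_ toℚ
  toℚ-injective {a} {b} eq
    with ℚᵘP.≃-trans (ℚᵘP.≃-sym (toℚᵘ-toℚ a)) (ℚᵘP.≃-trans (ℚP.toℚᵘ-cong eq) (toℚᵘ-toℚ b))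
  ... | *≡* a*1≡b*1 = trans (sym (ℤP.*-identityʳ a)) (trans a*1≡b*1 (ℤP.*-identityʳ b))

  toℚ[1+m]*inv[1+m]≡1 : ∀ m → toℚ (+ suc m) ℚ.* inv (suc m) ≡ ℚ.1ℚ
  toℚ[1+m]*inv[1+m]≡1 m = ℚP.toℚᵘ-injective (begin
    ℚ.toℚᵘ (toℚ (+ suc m) ℚ.* inv (suc m))               ≈⟨ ℚP.toℚᵘ-homo-* (toℚ (+ suc m)) (inv (suc m)) ⟩
    ℚ.toℚᵘ (toℚ (+ suc m)) ℚᵘ.* ℚ.toℚᵘ (inv (suc m))     ≈⟨ ℚᵘP.*-cong (toℚᵘ-toℚ (+ suc m)) (ℚP.toℚᵘ-fromℚᵘ (mkℚᵘ (+ 1) m)) ⟩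
    mkℚᵘ (+ suc m) 0 ℚᵘ.* mkℚᵘ (+ 1) m                   ≈⟨ ℚᵘP.*-inverseʳ (mkℚᵘ (+ suc m) 0) ⟩
    ℚᵘ.1ℚᵘ                                               ∎)
    where open ℚᵘP.≃-Reasoning

open Rationals

module Projection {n} (v : Pt n) {m} (‖v‖²≡1+m : normSq v ≡ suc m) where
  open Data.Integer using (_+_; _-_; _*_; -_)

  N : ℤ
  N = + normSq v

  I : ℚ
  I = inv (normSq v)

  instance
    N≢0 : Data.Integer.NonZero N
    N≢0 rewrite ‖v‖²≡1+m = _

  N*I≡1 : toℚ N ℚ.* I ≡ ℚ.1ℚ
  N*I≡1 rewrite ‖v‖²≡1+m = toℚ[1+m]*inv[1+m]≡1 m

  ⟪v,v⟫≡N : ⟪ v , v ⟫ ≡ N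
  ⟪v,v⟫≡N = trans (⟪v,v⟫≡sumSq v) (cong +_ (sym (normSq≡sumSq v)))

  -- N · proj v u, which has integer entries
  π : Pt n → Pt n
  π u = (N · u) ⊕ ((- ⟪ u , v ⟫) · v)

  divide : ℤ → ℚ
  divide q = toℚ q ℚ.* I

  divide-injective : Injective _≡_ _≡_ divide
  divide-injective {q} {q'} eq = toℚ-injective (trans (sym (undo q)) (trans (cong (ℚ._* toℚ N) eq) (undo q')))
    where
    undo : ∀ q → divide q ℚ.* toℚ N ≡ toℚ q
    undo q = begin
      (toℚ q ℚ.* I) ℚ.* toℚ N   ≡⟨ ℚP.*-assoc (toℚ q) I (toℚ N) ⟩
      toℚ q ℚ.* (I ℚ.* toℚ N)   ≡⟨ cong (toℚ q ℚ.*_) (trans (ℚP.*-comm I (toℚ N)) N*I≡1) ⟩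
      toℚ q ℚ.* ℚ.1ℚ            ≡⟨ ℚP.*-identityʳ (toℚ q) ⟩
      toℚ q                     ∎
      where open ≡-Reasoning

  proj≡divide∘π : ∀ u → proj v u ≡ Vec.map divide (π u)
  proj≡divide∘π u = pointwise u v
    where
    d = ⟪ u , v ⟫
    coordinate : ∀ x y → toℚ x ℚ.- (toℚ d ℚ.* I) ℚ.* toℚ y ≡ divide (N * x + - d * y)
    coordinate x y = sym (begin
      toℚ (N * x + - d * y) ℚ.* I                                  ≡⟨ cong (ℚ._* I) expand ⟩
      (toℚ N ℚ.* toℚ x ℚ.+ ℚ.- toℚ d ℚ.* toℚ y) ℚ.* I              ≡⟨ regroup (toℚ N) (toℚ x) (toℚ d) (toℚ y) I ⟩
      toℚ x ℚ.* (toℚ N ℚ.* I) ℚ.- (toℚ d ℚ.* I) ℚ.* toℚ y          ≡⟨ cong (λ r → toℚ x ℚ.* r ℚ.- (toℚ d ℚ.* I) ℚ.* toℚ y) N*I≡1 ⟩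
      toℚ x ℚ.* ℚ.1ℚ ℚ.- (toℚ d ℚ.* I) ℚ.* toℚ y                   ≡⟨ cong (ℚ._- (toℚ d ℚ.* I) ℚ.* toℚ y) (ℚP.*-identityʳ (toℚ x)) ⟩
      toℚ x ℚ.- (toℚ d ℚ.* I) ℚ.* toℚ y                             ∎)
      where
      open ≡-Reasoning
      expand : toℚ (N * x + - d * y) ≡ toℚ N ℚ.* toℚ x ℚ.+ ℚ.- toℚ d ℚ.* toℚ y
      expand = begin
        toℚ (N * x + - d * y)                     ≡⟨ toℚ-+ (N * x) (- d * y) ⟩
        toℚ (N * x) ℚ.+ toℚ (- d * y)             ≡⟨ cong₂ ℚ._+_ (toℚ-* N x) (toℚ-* (- d) y) ⟩
        toℚ N ℚ.* toℚ x ℚ.+ toℚ (- d) ℚ.* toℚ y   ≡⟨ cong (λ r → toℚ N ℚ.* toℚ x ℚ.+ r ℚ.* toℚ y) (toℚ-neg d) ⟩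
        toℚ N ℚ.* toℚ x ℚ.+ ℚ.- toℚ d ℚ.* toℚ y   ∎
      regroup : ∀ n x d y i → (n ℚ.* x ℚ.+ ℚ.- d ℚ.* y) ℚ.* i ≡ x ℚ.* (n ℚ.* i) ℚ.- (d ℚ.* i) ℚ.* y
      regroup = solve 5 (λ n x d y i → (n :* x :+ :- d :* y) :* i := x :* (n :* i) :+ :- ((d :* i) :* y)) refl
        where open +-*-Solver
    pointwise : ∀ {k} (x y : Pt k) →
      Vec.zipWith (λ xᵢ yᵢ → toℚ xᵢ ℚ.- (toℚ d ℚ.* I) ℚ.* toℚ yᵢ) x y ≡ Vec.map divide ((N · x) ⊕ ((- d) · y))
    pointwise []      []      = refl
    pointwise (a ∷ x) (b ∷ y) = cong₂ _∷_ (coordinate a b) (pointwise x y)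

  π-shift : ∀ u t → π (u ⊕ (t · v)) ≡ π u
  π-shift u t = begin
    (N · (u ⊕ (t · v))) ⊕ ((- ⟪ u ⊕ (t · v) , v ⟫) · v)   ≡⟨ cong (λ r → (N · (u ⊕ (t · v))) ⊕ ((- r) · v)) ⟪u⊕tv,v⟫≡d+tN ⟩
    (N · (u ⊕ (t · v))) ⊕ ((- (d + t * N)) · v)          ≡⟨ pointwise u v ⟩
    (N · u) ⊕ ((- d) · v)                                ∎
    where
    open ≡-Reasoning
    d = ⟪ u , v ⟫
    ⟪u⊕tv,v⟫≡d+tN : ⟪ u ⊕ (t · v) , v ⟫ ≡ d + t * N
    ⟪u⊕tv,v⟫≡d+tN = trans (⟪⟫-linearˡ u v v t) (cong (λ r → d + t * r) ⟪v,v⟫≡N)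
    coordinate : ∀ N d t x y → N * (x + t * y) + - (d + t * N) * y ≡ N * x + - d * y
    coordinate = solve-∀
    pointwise : ∀ {k} (x y : Pt k) → (N · (x ⊕ (t · y))) ⊕ ((- (d + t * N)) · y) ≡ (N · x) ⊕ ((- d) · y)
    pointwise []      []      = refl
    pointwise (a ∷ x) (b ∷ y) = cong₂ _∷_ (coordinate N d t a b) (pointwise x y)

  proj-shift : ∀ u t → proj v (u ⊕ (t · v)) ≡ proj v u
  proj-shift u t = begin
    proj v (u ⊕ (t · v))            ≡⟨ proj≡divide∘π (u ⊕ (t · v)) ⟩
    Vec.map divide (π (u ⊕ (t · v))) ≡⟨ cong (Vec.map divide) (π-shift u t) ⟩
    Vec.map divide (π u)            ≡⟨ proj≡divide∘π u ⟨
    proj v u                        ∎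
    where open ≡-Reasoning

  π-cancel : ∀ {k} d d' t → d' - d ≡ N * t →
             ∀ (x x' y : Pt k) → (N · x) ⊕ ((- d) · y) ≡ (N · x') ⊕ ((- d') · y) → x' ≡ x ⊕ (t · y)
  π-cancel d d' t _        []      []        []      _  = refl
  π-cancel d d' t d'-d≡Nt (a ∷ x) (a' ∷ x') (b ∷ y) eq with ∷-injective eq
  ... | head≡ , tail≡ = cong₂ _∷_ (ℤP.*-cancelˡ-≡ N a' (a + t * b) Na'≡N[a+tb]) (π-cancel d d' t d'-d≡Nt x x' y tail≡)
    where
    open ≡-Reasoning
    Na'≡N[a+tb] : N * a' ≡ N * (a + t * b)
    Na'≡N[a+tb] = begin
      N * a'                          ≡⟨ split N a' d' b ⟩
      (N * a' + - d' * b) + d' * b    ≡⟨ cong (_+ d' * b) head≡ ⟨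
      (N * a + - d * b) + d' * b      ≡⟨ merge N a d b d' ⟩
      N * a + (d' - d) * b            ≡⟨ cong (λ r → N * a + r * b) d'-d≡Nt ⟩
      N * a + (N * t) * b             ≡⟨ factor N a t b ⟩
      N * (a + t * b)                 ∎
      where
      split : ∀ N a d b → N * a ≡ (N * a + - d * b) + d * b
      split = solve-∀
      merge : ∀ N a d b d' → (N * a + - d * b) + d' * b ≡ N * a + (d' - d) * b
      merge = solve-∀
      factor : ∀ N a t b → N * a + (N * t) * b ≡ N * (a + t * b)
      factor = solve-∀

  module _ (a : Pt n) (⟪v,a⟫≡1 : ⟪ v , a ⟫ ≡ + 1) where

    ⟪π,a⟫ : ∀ u → ⟪ π u , a ⟫ ≡ N * ⟪ u , a ⟫ - ⟪ u , v ⟫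
    ⟪π,a⟫ u = begin
      ⟪ (N · u) ⊕ ((- d) · v) , a ⟫     ≡⟨ ⟪⟫-linearˡ (N · u) v a (- d) ⟩
      ⟪ N · u , a ⟫ + - d * ⟪ v , a ⟫   ≡⟨ cong₂ (λ p q → p + - d * q) (⟪⟫-homogeneousˡ N u a) ⟪v,a⟫≡1 ⟩
      N * ⟪ u , a ⟫ + - d * + 1         ≡⟨ tidy (N * ⟪ u , a ⟫) d ⟩
      N * ⟪ u , a ⟫ - d                 ∎
      where
      open ≡-Reasoning
      d = ⟪ u , v ⟫
      tidy : ∀ p d → p + - d * + 1 ≡ p - d
      tidy = solve-∀

    proj-fiber : ∀ u u' → proj v u ≡ proj v u' → u' ≡ u ⊕ ((⟪ u' , a ⟫ - ⟪ u , a ⟫) · v)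
    proj-fiber u u' eq = π-cancel d d' (ℓ' - ℓ) d'-d≡N[ℓ'-ℓ] u u' v πu≡πu'
      where
      open ≡-Reasoning
      d = ⟪ u , v ⟫ ; d' = ⟪ u' , v ⟫ ; ℓ = ⟪ u , a ⟫ ; ℓ' = ⟪ u' , a ⟫
      πu≡πu' : π u ≡ π u'
      πu≡πu' = map-injective divide-injective (trans (sym (proj≡divide∘π u)) (trans eq (proj≡divide∘π u')))
      d'-d≡N[ℓ'-ℓ] : d' - d ≡ N * (ℓ' - ℓ)
      d'-d≡N[ℓ'-ℓ] = begin
        d' - d                                           ≡⟨ expand N ℓ d ℓ' d' ⟩
        (N * ℓ - d) - (N * ℓ' - d') + N * (ℓ' - ℓ)       ≡⟨ cong (λ r → r - (N * ℓ' - d') + N * (ℓ' - ℓ)) Nℓ-d≡Nℓ'-d' ⟩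
        (N * ℓ' - d') - (N * ℓ' - d') + N * (ℓ' - ℓ)     ≡⟨ collapse (N * ℓ' - d') (N * (ℓ' - ℓ)) ⟩
        N * (ℓ' - ℓ)                                     ∎
        where
        Nℓ-d≡Nℓ'-d' : N * ℓ - d ≡ N * ℓ' - d'
        Nℓ-d≡Nℓ'-d' = trans (sym (⟪π,a⟫ u)) (trans (cong ⟪_, a ⟫ πu≡πu') (⟪π,a⟫ u'))
        expand : ∀ N ℓ d ℓ' d' → d' - d ≡ (N * ℓ - d) - (N * ℓ' - d') + N * (ℓ' - ℓ)
        expand = solve-∀
        collapse : ∀ p q → p - p + q ≡ q
        collapse = solve-∀

infix 4 _≟_
_≟_ : ∀ {n} → DecidableEquality (Pt n)
_≟_ = ≡-dec ℤP._≟_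

Adj-sym : ∀ {n k} {vs : Fin k → Pt n} {u w} → Adj vs u w → Adj vs w u
Adj-sym {vs = vs} {u} (i , inj₁ refl) = i , inj₂ (sym (trans (x⊖v≡x⊕-v (u ⊕ vs i) (vs i)) (x⊕v⊕-v≡x u (vs i))))
Adj-sym {vs = vs} {u} (i , inj₂ refl) = i , inj₁ (sym (trans (cong (_⊕ vs i) (x⊖v≡x⊕-v u (vs i))) (x⊕-v⊕v≡x u (vs i))))

module Crossings {n} (S : List (Pt n)) where
  open DecMembership (_≟_ {n}) using (_∈?_)

  T : List (Pt n)
  T = deduplicate _≟_ S

  T-unique : Unique T
  T-unique = deduplicate-! _≟_ S

  ∈S⇒∈T : ∀ {x} → x ∈ S → x ∈ T
  ∈S⇒∈T = ∈-deduplicate⁺ _≟_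

  ∈T⇒∈S : ∀ {x} → x ∈ T → x ∈ S
  ∈T⇒∈S = ∈-deduplicate⁻ _≟_ S

  stays : Pt n → List (Pt n)
  stays d = filter (λ x → (x ⊕ d) ∈? S) T

  exits : Pt n → List (Pt n)
  exits d = filter (λ x → ¬? ((x ⊕ d) ∈? S)) T

  exits-unique : ∀ d → Unique (exits d)
  exits-unique d = UniqueP.filter⁺ _ T-unique

  ∈-exits⁺ : ∀ {d x} → x ∈ S → x ⊕ d ∉ S → x ∈ exits d
  ∈-exits⁺ x∈S = ∈-filter⁺ _ (∈S⇒∈T x∈S)

  ∈-exits⁻ : ∀ {d x} → x ∈ exits d → x ∈ S × x ⊕ d ∉ S
  ∈-exits⁻ x∈ with ∈-filter⁻ _ x∈
  ... | x∈T , x⊕d∉S = ∈T⇒∈S x∈T , x⊕d∉S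

  length-stays-negV : ∀ v → length (stays (negV v)) ≡ length (stays v)
  length-stays-negV v = begin
    length (stays (negV v))          ≡⟨ unique-set⇒length≡ (UniqueP.filter⁺ _ T-unique) translate-unique translate-set ⟩
    length (map (_⊕ v) (stays v))    ≡⟨ ListP.length-map (_⊕ v) (stays v) ⟩
    length (stays v)                 ∎
    where
    open ≡-Reasoning
    translate-unique : Unique (map (_⊕ v) (stays v))
    translate-unique = UniqueP.map⁺ (⊕-cancelʳ v) (UniqueP.filter⁺ _ T-unique)
    translate-set : ∀ {y} → y ∈ stays (negV v) ⇔ y ∈ map (_⊕ v) (stays v)
    translate-set {y} = mk⇔ to from
      where
      to : y ∈ stays (negV v) → y ∈ map (_⊕ v) (stays v)
      to y∈ with ∈-filter⁻ _ y∈
      ... | y∈T , y⊕-v∈S = subst (_∈ map (_⊕ v) (stays v)) (x⊕-v⊕v≡x y v)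
                             (∈-map⁺ (_⊕ v) (∈-filter⁺ _ (∈S⇒∈T y⊕-v∈S) (subst (_∈ S) (sym (x⊕-v⊕v≡x y v)) (∈T⇒∈S y∈T))))
      from : y ∈ map (_⊕ v) (stays v) → y ∈ stays (negV v)
      from y∈ with ∈-map∘filter⁻ (_⊕ v) (λ x → (x ⊕ v) ∈? S) y∈
      ... | x , x∈T , refl , x⊕v∈S = ∈-filter⁺ _ (∈S⇒∈T x⊕v∈S) (subst (_∈ S) (sym (x⊕v⊕-v≡x x v)) (∈T⇒∈S x∈T))

  length-exits-negV : ∀ v → length (exits (negV v)) ≡ length (exits v)
  length-exits-negV v = ℕP.+-cancelˡ-≡ (length (stays v)) _ _ (begin
    length (stays v) ℕ.+ length (exits (negV v))          ≡⟨ cong (ℕ._+ length (exits (negV v))) (length-stays-negV v) ⟨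
    length (stays (negV v)) ℕ.+ length (exits (negV v))   ≡⟨ length-filter-split _ T ⟩
    length T                                              ≡⟨ length-filter-split _ T ⟨
    length (stays v) ℕ.+ length (exits v)                 ∎)
    where open ≡-Reasoning

  Crossing : Pt n × Pt n → Set
  Crossing (u , w) = u ∈ S × w ∉ S

  crossEdges : Pt n → List (Pt n × Pt n)
  crossEdges d = map (λ x → x , x ⊕ d) (exits d)

  ∈-crossEdges⁺ : ∀ {d u} → u ∈ S → u ⊕ d ∉ S → (u , u ⊕ d) ∈ crossEdges d
  ∈-crossEdges⁺ u∈S u⊕d∉S = ∈-map⁺ _ (∈-exits⁺ u∈S u⊕d∉S)

  ∈-crossEdges⁻ : ∀ {d u w} → (u , w) ∈ crossEdges d → Crossing (u , w) × w ≡ u ⊕ d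
  ∈-crossEdges⁻ p∈ with ∈-map⁻ _ p∈
  ... | x , x∈ , refl = ∈-exits⁻ x∈ , refl

  crossEdges-unique : ∀ d → Unique (crossEdges d)
  crossEdges-unique d = UniqueP.map⁺ (cong proj₁) (exits-unique d)

  lineEdges : Pt n → List (Pt n × Pt n)
  lineEdges v = crossEdges v ++ crossEdges (negV v)

  length-lineEdges : ∀ v → length (lineEdges v) ≡ 2 ℕ.* length (exits v)
  length-lineEdges v = begin
    length (crossEdges v ++ crossEdges (negV v))          ≡⟨ ListP.length-++ (crossEdges v) ⟩
    length (crossEdges v) ℕ.+ length (crossEdges (negV v)) ≡⟨ cong₂ ℕ._+_ (ListP.length-map _ (exits v)) (ListP.length-map _ (exits (negV v))) ⟩
    length (exits v) ℕ.+ length (exits (negV v))          ≡⟨ cong (length (exits v) ℕ.+_) (trans (length-exits-negV v) (sym (ℕP.+-identityʳ _))) ⟩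
    2 ℕ.* length (exits v)                                ∎
    where open ≡-Reasoning

  ∈-lineEdges⁻ : ∀ {v u w} → (u , w) ∈ lineEdges v → Crossing (u , w) × (w ≡ u ⊕ v ⊎ w ≡ u ⊕ negV v)
  ∈-lineEdges⁻ {v} p∈ with ∈-++⁻ (crossEdges v) p∈
  ... | inj₁ p∈₊ with ∈-crossEdges⁻ p∈₊
  ...   | crossing , w≡ = crossing , inj₁ w≡
  ∈-lineEdges⁻ {v} p∈ | inj₂ p∈₋ with ∈-crossEdges⁻ p∈₋
  ...   | crossing , w≡ = crossing , inj₂ w≡

  lineEdges-direction : ∀ {v v' p} → p ∈ lineEdges v → p ∈ lineEdges v' → v ≡ v' ⊎ v ≡ negV v'
  lineEdges-direction {v} {v'} {u , w} p∈ p∈' with proj₂ (∈-lineEdges⁻ p∈) | proj₂ (∈-lineEdges⁻ p∈')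
  ... | inj₁ refl | inj₁ eq = inj₁ (⊕-cancelˡ u eq)
  ... | inj₁ refl | inj₂ eq = inj₂ (⊕-cancelˡ u eq)
  ... | inj₂ refl | inj₁ eq = inj₂ (trans (sym (negV-involutive v)) (cong negV (⊕-cancelˡ u eq)))
  ... | inj₂ refl | inj₂ eq = inj₁ (trans (sym (negV-involutive v)) (trans (cong negV (⊕-cancelˡ u eq)) (negV-involutive v')))

  lineEdges-unique : ∀ v → ¬ v ≡ negV v → Unique (lineEdges v)
  lineEdges-unique v v≢-v = UniqueP.++⁺ (crossEdges-unique v) (crossEdges-unique (negV v)) disjoint
    where
    disjoint : ∀ {p} → p ∈ crossEdges v × p ∈ crossEdges (negV v) → ⊥
    disjoint {u , w} (p∈₊ , p∈₋) = v≢-v (⊕-cancelˡ u (trans (sym (proj₂ (∈-crossEdges⁻ p∈₊))) (proj₂ (∈-crossEdges⁻ p∈₋))))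

  boundaryEdges : ∀ {k} → (Fin k → Pt n) → List (Pt n × Pt n)
  boundaryEdges {zero}  vs = []
  boundaryEdges {suc k} vs = lineEdges (vs Fin.zero) ++ boundaryEdges (vs ∘ Fin.suc)

  length-boundaryEdges : ∀ {k} (vs : Fin k → Pt n) →
    length (boundaryEdges vs) ≡ 2 ℕ.* sumFin (λ i → length (exits (vs i)))
  length-boundaryEdges {zero}  vs = refl
  length-boundaryEdges {suc k} vs = begin
    length (lineEdges (vs Fin.zero) ++ boundaryEdges (vs ∘ Fin.suc))            ≡⟨ ListP.length-++ (lineEdges (vs Fin.zero)) ⟩
    length (lineEdges (vs Fin.zero)) ℕ.+ length (boundaryEdges (vs ∘ Fin.suc)) ≡⟨ cong₂ ℕ._+_ (length-lineEdges (vs Fin.zero)) (length-boundaryEdges (vs ∘ Fin.suc)) ⟩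
    2 ℕ.* e₀ ℕ.+ 2 ℕ.* eₛ                                                      ≡⟨ ℕP.*-distribˡ-+ 2 e₀ eₛ ⟨
    2 ℕ.* sumFin (λ i → length (exits (vs i)))                                  ∎
    where
    open ≡-Reasoning
    e₀ = length (exits (vs Fin.zero))
    eₛ = sumFin (λ i → length (exits (vs (Fin.suc i))))

  ∈-boundaryEdges⁺ : ∀ {k} (vs : Fin k → Pt n) i {p} → p ∈ lineEdges (vs i) → p ∈ boundaryEdges vs
  ∈-boundaryEdges⁺ {suc k} vs Fin.zero    p∈ = ∈-++⁺ˡ p∈
  ∈-boundaryEdges⁺ {suc k} vs (Fin.suc i) p∈ = ∈-++⁺ʳ (lineEdges (vs Fin.zero)) (∈-boundaryEdges⁺ (vs ∘ Fin.suc) i p∈)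

  ∈-boundaryEdges⁻ : ∀ {k} (vs : Fin k → Pt n) {p} → p ∈ boundaryEdges vs → ∃ λ i → p ∈ lineEdges (vs i)
  ∈-boundaryEdges⁻ {suc k} vs p∈ with ∈-++⁻ (lineEdges (vs Fin.zero)) p∈
  ... | inj₁ p∈₀ = Fin.zero , p∈₀
  ... | inj₂ p∈ₛ with ∈-boundaryEdges⁻ (vs ∘ Fin.suc) p∈ₛ
  ...   | i , p∈ᵢ = Fin.suc i , p∈ᵢ

  boundaryEdges-unique : ∀ {k} (vs : Fin k → Pt n) → (∀ i j → vs i ≡ vs j → i ≡ j) →
    (∀ i j → ¬ vs i ≡ negV (vs j)) → Unique (boundaryEdges vs)
  boundaryEdges-unique {zero}  vs distinct notOpp = []
  boundaryEdges-unique {suc k} vs distinct notOpp =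
    UniqueP.++⁺ (lineEdges-unique (vs Fin.zero) (notOpp Fin.zero Fin.zero))
                (boundaryEdges-unique (vs ∘ Fin.suc) (λ i j → FinP.suc-injective ∘ distinct (Fin.suc i) (Fin.suc j))
                                                     (λ i j → notOpp (Fin.suc i) (Fin.suc j)))
                disjoint
    where
    disjoint : ∀ {p} → p ∈ lineEdges (vs Fin.zero) × p ∈ boundaryEdges (vs ∘ Fin.suc) → ⊥
    disjoint (p∈₀ , p∈ₛ) with ∈-boundaryEdges⁻ (vs ∘ Fin.suc) p∈ₛ
    ... | i , p∈ᵢ with lineEdges-direction p∈₀ p∈ᵢ
    ...   | inj₁ v₀≡vᵢ  = FinP.0≢1+n (distinct Fin.zero (Fin.suc i) v₀≡vᵢ)
    ...   | inj₂ v₀≡-vᵢ = notOpp Fin.zero (Fin.suc i) v₀≡-vᵢ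

  ∈-boundaryEdges-crossing : ∀ {k} (vs : Fin k → Pt n) {u w} → Adj vs u w → u ∈ S → w ∉ S → (u , w) ∈ boundaryEdges vs
  ∈-boundaryEdges-crossing vs (i , inj₁ refl) u∈S w∉S = ∈-boundaryEdges⁺ vs i (∈-++⁺ˡ (∈-crossEdges⁺ u∈S w∉S))
  ∈-boundaryEdges-crossing vs {u} (i , inj₂ refl) u∈S w∉S =
    ∈-boundaryEdges⁺ vs i (∈-++⁺ʳ (crossEdges (vs i))
      (subst (λ w → (u , w) ∈ crossEdges (negV (vs i))) (sym (x⊖v≡x⊕-v u (vs i)))
        (∈-crossEdges⁺ u∈S (subst (_∉ S) (x⊖v≡x⊕-v u (vs i)) w∉S))))

  boundary-card : ∀ {k} (vs : Fin k → Pt n) → (∀ i j → vs i ≡ vs j → i ≡ j) →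
    (∀ i j → ¬ vs i ≡ negV (vs j)) → HasCard SameEdge (InBoundary vs S) (length (boundaryEdges vs))
  boundary-card vs distinct notOpp =
    boundaryEdges vs , refl , All.tabulate inBoundary ,
    AllPairs-mapWithAll (All.tabulate crossing) distinct-edges (boundaryEdges-unique vs distinct notOpp) ,
    covers
    where
    crossing : ∀ {p} → p ∈ boundaryEdges vs → Crossing p
    crossing p∈ = proj₁ (∈-lineEdges⁻ (proj₂ (∈-boundaryEdges⁻ vs p∈)))
    inBoundary : ∀ {p} → p ∈ boundaryEdges vs → InBoundary vs S p
    inBoundary {u , w} p∈ with ∈-boundaryEdges⁻ vs p∈
    ... | i , p∈ᵢ with ∈-lineEdges⁻ p∈ᵢ
    ...   | (u∈S , w∉S) , inj₁ w≡u⊕v  = (i , inj₁ w≡u⊕v) , inj₁ (u∈S , w∉S)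
    ...   | (u∈S , w∉S) , inj₂ w≡u⊕-v = (i , inj₂ (trans w≡u⊕-v (sym (x⊖v≡x⊕-v u (vs i))))) , inj₁ (u∈S , w∉S)
    distinct-edges : ∀ {p q} → Crossing p → Crossing q → ¬ p ≡ q → ¬ SameEdge p q
    distinct-edges _ _ p≢q (inj₁ (refl , refl)) = p≢q refl
    distinct-edges (u∈S , _) (_ , w'∉S) _ (inj₂ (refl , _)) = w'∉S u∈S
    covers : ∀ p → InBoundary vs S p → Any (SameEdge p) (boundaryEdges vs)
    covers (u , w) (adj , inj₁ (u∈S , w∉S)) = lose (∈-boundaryEdges-crossing vs adj u∈S w∉S) (inj₁ (refl , refl))
    covers (u , w) (adj , inj₂ (u∉S , w∈S)) = lose (∈-boundaryEdges-crossing vs (Adj-sym adj) w∈S u∉S) (inj₂ (refl , refl))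

module Lines {n} (S : List (Pt n)) (v a : Pt n) (⟪v,a⟫≡1 : ⟪ v , a ⟫ ≡ + 1) {m} (‖v‖²≡1+m : normSq v ≡ suc m) where
  open Data.Integer using (_+_; _-_; _*_; -_; _≤_; _<_)
  open Crossings S
  open Projection v ‖v‖²≡1+m using (proj-shift; proj-fiber)

  ℓ : Pt n → ℤ
  ℓ x = ⟪ x , a ⟫

  ℓ-shift : ∀ x t → ℓ (x ⊕ (t · v)) ≡ ℓ x + t
  ℓ-shift x t = begin
    ⟪ x ⊕ (t · v) , a ⟫   ≡⟨ ⟪⟫-linearˡ x v a t ⟩
    ℓ x + t * ⟪ v , a ⟫   ≡⟨ cong (λ r → ℓ x + t * r) ⟪v,a⟫≡1 ⟩
    ℓ x + t * + 1         ≡⟨ cong (λ r → ℓ x + r) (ℤP.*-identityʳ t) ⟩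
    ℓ x + t               ∎
    where open ≡-Reasoning

  shift≡ℓ-difference : ∀ x t {z} → z ≡ x ⊕ (t · v) → ℓ z - ℓ x ≡ t
  shift≡ℓ-difference x t refl = trans (cong (_- ℓ x) (ℓ-shift x t)) (cancel (ℓ x) t)
    where cancel : ∀ p t → p + t - p ≡ t
          cancel = solve-∀

  _≺_ : Pt n → Pt n → Set
  x ≺ z = ∃ λ b → 1 ℕ.≤ b × z ≡ x ⊕ ((+ b) · v)

  -- the only candidate step from x to z is ℓ z - ℓ x
  _≺?_ : ∀ x z → Dec (x ≺ z)
  x ≺? z with ℓ z - ℓ x in ℓz-ℓx≡t
  ... | + suc b  = Dec.map′ (λ z≡ → suc b , s≤s z≤n , z≡) from (z ≟ x ⊕ ((+ suc b) · v))
    where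
    from : x ≺ z → z ≡ x ⊕ ((+ suc b) · v)
    from (b' , _ , z≡) = subst (λ t → z ≡ x ⊕ (t · v)) (trans (sym (shift≡ℓ-difference x (+ b') z≡)) ℓz-ℓx≡t) z≡
  ... | + zero   = no λ (b , 1≤b , z≡) →
    contradiction (ℤP.+-injective (trans (sym (shift≡ℓ-difference x (+ b) z≡)) ℓz-ℓx≡t)) (ℕP.m<n⇒n≢0 1≤b)
  ... | -[1+ c ] = no λ (b , _ , z≡) → case trans (sym (shift≡ℓ-difference x (+ b) z≡)) ℓz-ℓx≡t of λ ()

  Shadowed : Pt n → Set
  Shadowed x = ∃ λ (b : ℕ) → 1 ℕ.≤ b × (x ⊕ ((+ b) · v)) ∈ S

  shadowed? : ∀ x → Dec (Shadowed x)
  shadowed? x = Dec.map′ to from (any? (x ≺?_) T)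
    where
    to : Any (x ≺_) T → Shadowed x
    to ≺z with find ≺z
    ... | z , z∈T , b , 1≤b , refl = b , 1≤b , ∈T⇒∈S z∈T
    from : Shadowed x → Any (x ≺_) T
    from (b , 1≤b , x⊕b·v∈S) = lose (∈S⇒∈T x⊕b·v∈S) (b , 1≤b , refl)

  shadowed-pred : ∀ {y} → Shadowed (y ⊕ v) → Shadowed y
  shadowed-pred {y} (b , _ , mem) = suc b , s≤s z≤n , subst (_∈ S) (x⊕v⊕b·v≡x⊕[1+b]·v y v b) mem

  shadowed-succ : ∀ {y} → y ⊕ v ∉ S → Shadowed y → Shadowed (y ⊕ v)
  shadowed-succ {y} y⊕v∉S (suc zero , _ , mem) = contradiction (subst (_∈ S) (x⊕1·v≡x⊕v y v) mem) y⊕v∉S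
  shadowed-succ {y} y⊕v∉S (suc (suc b) , _ , mem) = suc b , s≤s z≤n , subst (_∈ S) (sym (x⊕v⊕b·v≡x⊕[1+b]·v y v (suc b))) mem

  lastPoints : List (Pt n)
  lastPoints = filter (¬? ∘ shadowed?) (exits v)

  beforeGaps : List (Pt n)
  beforeGaps = filter shadowed? (exits v)

  ∈-lastPoints⁻ : ∀ {y} → y ∈ lastPoints → y ∈ S × ¬ Shadowed y
  ∈-lastPoints⁻ y∈ with ∈-filter⁻ _ y∈
  ... | y∈exits , unshadowed = proj₁ (∈-exits⁻ y∈exits) , unshadowed

  ∈-lastPoints⁺ : ∀ {y} → y ∈ S → ¬ Shadowed y → y ∈ lastPoints
  ∈-lastPoints⁺ {y} y∈S unshadowed = ∈-filter⁺ _ (∈-exits⁺ y∈S y⊕v∉S) unshadowed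
    where y⊕v∉S : y ⊕ v ∉ S
          y⊕v∉S y⊕v∈S = unshadowed (1 , s≤s z≤n , subst (_∈ S) (sym (x⊕1·v≡x⊕v y v)) y⊕v∈S)

  lastPoints-proj-injective : ∀ {y y'} → y ∈ lastPoints → y' ∈ lastPoints → proj v y ≡ proj v y' → y ≡ y'
  lastPoints-proj-injective {y} {y'} y∈ y'∈ eq = on-line (ℓ y' - ℓ y) (proj-fiber a ⟪v,a⟫≡1 y y' eq)
    where
    on-line : ∀ t → y' ≡ y ⊕ (t · v) → y ≡ y'
    on-line (+ zero)   y'≡ = sym (trans y'≡ (x⊕0·v≡x y v))
    on-line (+ suc b)  y'≡ = ⊥-elim (proj₂ (∈-lastPoints⁻ y∈) (suc b , s≤s z≤n , subst (_∈ S) y'≡ (proj₁ (∈-lastPoints⁻ y'∈))))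
    on-line -[1+ b ]   y'≡ = ⊥-elim (proj₂ (∈-lastPoints⁻ y'∈) (suc b , s≤s z≤n , subst (_∈ S) y≡ (proj₁ (∈-lastPoints⁻ y∈))))
      where y≡ : y ≡ y' ⊕ ((+ suc b) · v)
            y≡ = sym (trans (cong (_⊕ ((+ suc b) · v)) y'≡) (x⊕[-t]·v⊕t·v≡x y v (+ suc b)))

  OnLine : Pt n → Pt n → Set
  OnLine u z = z ≡ u ⊕ ((ℓ z - ℓ u) · v)

  onLine : ∀ u t {z} → z ≡ u ⊕ (t · v) → OnLine u z
  onLine u t z≡ = subst (λ s → _ ≡ u ⊕ (s · v)) (sym (shift≡ℓ-difference u t z≡)) z≡

  line : Pt n → List (Pt n)
  line u = filter (λ z → z ≟ u ⊕ ((ℓ z - ℓ u) · v)) T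

  lastOnLine : Pt n → Pt n
  lastOnLine u = argmax ℓ u (line u)

  module _ {u} (u∈S : u ∈ S) where

    lastOnLine-onLine : lastOnLine u ∈ S × OnLine u (lastOnLine u)
    lastOnLine-onLine = argmax-all ℓ (u∈S , onLine u (+ 0) (sym (x⊕0·v≡x u v))) (All.tabulate onLine-∈S)
      where onLine-∈S : ∀ {z} → z ∈ line u → z ∈ S × OnLine u z
            onLine-∈S z∈ with ∈-filter⁻ _ z∈
            ... | z∈T , on = ∈T⇒∈S z∈T , on

    lastOnLine-unshadowed : ¬ Shadowed (lastOnLine u)
    lastOnLine-unshadowed (b , 1≤b , z'∈S) = ℤP.<⇒≱ ℓz<ℓz' ℓz'≤ℓz
      where
      z  = lastOnLine u
      z' = z ⊕ ((+ b) · v)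
      z'-onLine : OnLine u z'
      z'-onLine = onLine u (ℓ z - ℓ u + + b)
        (trans (cong (_⊕ ((+ b) · v)) (proj₂ lastOnLine-onLine)) (x⊕s·v⊕t·v≡x⊕[s+t]·v u v (ℓ z - ℓ u) (+ b)))
      ℓz'≤ℓz : ℓ z' ≤ ℓ z
      ℓz'≤ℓz = All.lookup (f[xs]≤f[argmax] {f = ℓ} u (line u)) (∈-filter⁺ _ (∈S⇒∈T z'∈S) z'-onLine)
      ℓz<ℓz' : ℓ z < ℓ z'
      ℓz<ℓz' = subst₂ _<_ (ℤP.+-identityʳ (ℓ z)) (sym (ℓ-shift z (+ b))) (ℤP.+-monoʳ-< (ℓ z) (+<+ 1≤b))

    lastPoint-exists : ∃ λ z → z ∈ lastPoints × proj v z ≡ proj v u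
    lastPoint-exists = lastOnLine u , ∈-lastPoints⁺ (proj₁ lastOnLine-onLine) lastOnLine-unshadowed ,
      trans (cong (proj v) (proj₂ lastOnLine-onLine)) (proj-shift u (ℓ (lastOnLine u) - ℓ u))

  projections : List (Vec ℚ n)
  projections = map (proj v) lastPoints

  gaps : List (Pt n)
  gaps = map (_⊕ v) beforeGaps

  length-exits : length (exits v) ≡ length projections ℕ.+ length gaps
  length-exits = begin
    length (exits v)                         ≡⟨ length-filter-split shadowed? (exits v) ⟨
    length beforeGaps ℕ.+ length lastPoints  ≡⟨ ℕP.+-comm (length beforeGaps) (length lastPoints) ⟩
    length lastPoints ℕ.+ length beforeGaps  ≡⟨ cong₂ ℕ._+_ (ListP.length-map (proj v) lastPoints) (ListP.length-map (_⊕ v) beforeGaps) ⟨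
    length projections ℕ.+ length gaps       ∎
    where open ≡-Reasoning

  proj-card : HasCard _≡_ (InProj v S) (length projections)
  proj-card = hasCard (map-unique-on (UniqueP.filter⁺ _ (exits-unique v)) lastPoints-proj-injective) sound complete
    where
    sound : ∀ {p} → p ∈ projections → InProj v S p
    sound p∈ with ∈-map⁻ (proj v) p∈
    ... | y , y∈ , p≡ = y , proj₁ (∈-lastPoints⁻ y∈) , p≡
    complete : ∀ {p} → InProj v S p → p ∈ projections
    complete (u , u∈S , refl) with lastPoint-exists u∈S
    ... | z , z∈ , pz≡pu = subst (_∈ projections) pz≡pu (∈-map⁺ (proj v) z∈)

  gap-card : HasCard _≡_ (InGap v S) (length gaps)
  gap-card = hasCard (UniqueP.map⁺ (⊕-cancelʳ v) (UniqueP.filter⁺ _ (exits-unique v))) sound complete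
    where
    sound : ∀ {x} → x ∈ gaps → InGap v S x
    sound x∈ with ∈-map⁻ (_⊕ v) x∈
    ... | y , y∈ , refl with ∈-filter⁻ _ y∈
    ...   | y∈exits , shadowed with ∈-exits⁻ y∈exits
    ...     | y∈S , y⊕v∉S =
      subst (_∈ S) (sym (trans (x⊖v≡x⊕-v (y ⊕ v) v) (x⊕v⊕-v≡x y v))) y∈S , y⊕v∉S , shadowed-succ y⊕v∉S shadowed
    complete : ∀ {x} → InGap v S x → x ∈ gaps
    complete {x} (x⊖v∈S , x∉S , shadowed) =
      subst (_∈ gaps) y⊕v≡x
        (∈-map⁺ (_⊕ v) (∈-filter⁺ _ (∈-exits⁺ x⊖v∈S (subst (_∉ S) (sym y⊕v≡x) x∉S))
                                    (shadowed-pred (subst Shadowed (sym y⊕v≡x) shadowed))))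
      where y⊕v≡x : (x ⊖ v) ⊕ v ≡ x
            y⊕v≡x = trans (cong (_⊕ v) (x⊖v≡x⊕-v x v)) (x⊕-v⊕v≡x x v)

open import Data.Nat using (_+_; _*_)

theorem2 : (n k : ℕ) (vs : Fin k → Pt n) → IsPL n k vs → (S : List (Pt n)) →
    Σ ℕ λ e → Σ (Fin k → ℕ) λ p → Σ (Fin k → ℕ) λ g →
      HasCard SameEdge (InBoundary vs S) e
      × (∀ i → HasCard _≡_ (InProj (vs i) S) (p i))
      × (∀ i → HasCard _≡_ (InGap (vs i) S) (g i))
      × e ≡ 2 * sumFin (λ i → p i + g i)
theorem2 n k vs pl S =
  length (boundaryEdges vs) , (λ i → length (L.projections i)) , (λ i → length (L.gaps i)) ,
  boundary-card vs distinct notOpp , L.proj-card , L.gap-card ,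
  trans (length-boundaryEdges vs) (cong (2 *_) (sumFin-cong L.length-exits))
  where
  open IsPL pl
  open Crossings S
  a : Fin k → Pt n
  a i = proj₁ (bézoutᵥ (vs i))
  ⟪v,a⟫≡1 : ∀ i → ⟪ vs i , a i ⟫ ≡ + 1
  ⟪v,a⟫≡1 i = trans (⟪⟫-comm (vs i) (a i)) (trans (proj₂ (bézoutᵥ (vs i))) (cong +_ (coprime i)))
  module L (i : Fin k) = Lines S (vs i) (a i) (⟪v,a⟫≡1 i) (proj₂ (normSq≡1+ (vs i) (notOpp i i)))
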